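{- Let $q$ be an odd prime number. Then $S(1,a,q)\neq0$ for every $a\in\mathbb{Z}$.
   Context: For integers $m,n$ and natural $c$, the Kloosterman sum is $S(m,n,c)=\sum_{x \bmod c,\ \gcd(x,c)=1}e^{2\pi i\frac{mx+n\overline{x}}{c}}$, where $\overline{x}$ is the inverse of $x$ modulo $c$. -}

module Defs where

open import Level using (Level)
open import Data.Nat as ℕ using (ℕ; zero; suc; NonZero)
open import Data.Nat.DivMod using (_%_)
open import Data.Nat.Coprimality using (Coprime; coprime?)
open import Data.Integer as ℤ using (ℤ; +_)
open import Data.Integer.DivMod using (_%ℕ_)
open import Data.List using (List; []; _∷_; upTo; filter; foldr; map)
open import Data.Bool using (if_then_else_)
open import Relation.Nullary.Decidable using (does)
open import Algebra.Bundles using (CommutativeRing; Semiring)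
open import Data.Empty using (⊥)
open import Data.Sum using (_⊎_)
open import Data.Product using () renaming (_×_ to _∧_)
open import Relation.Binary.PropositionalEquality using (_≡_)

-- Inverse of x modulo c: the least y in [0, c) with x * y ≡ 1 (mod c)
-- (falls back to 0 if none exists; only used for gcd(x,c) = 1, where it exists).
invFrom : (c x : ℕ) .{{_ : NonZero c}} → List ℕ → ℕ
invFrom c x []       = 0
invFrom c x (y ∷ ys) = if does ((x ℕ.* y) % c ℕ.≟ 1 % c) then y else invFrom c x ys

inv : (c x : ℕ) .{{_ : NonZero c}} → ℕ
inv c x = invFrom c x (upTo c)

units : ℕ → List ℕ
units c = filter (λ x → coprime? x c) (upTo c)

module _ {c₁ ℓ : Level} (R : CommutativeRing c₁ ℓ) where
  open CommutativeRing R
  open import Algebra.Definitions.RawSemiring (Semiring.rawSemiring semiring) using (_^_; _×_)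

  -- Kloosterman sum S(m,n,c) = Σ_{x mod c, (x,c)=1} e((m x + n x̄)/c),
  -- with e(1/c) = exp(2πi/c) realised as a primitive c-th root of unity ζ in R.
  -- Since ζ^c = 1, ζ^k only depends on k mod c, so we use the residue in [0,c).
  kloosterman : (ζ : Carrier) (m n : ℤ) (c : ℕ) .{{_ : NonZero c}} → Carrier
  kloosterman ζ m n c =
    foldr _+_ 0# (map (λ x → ζ ^ ((m ℤ.* + x ℤ.+ n ℤ.* + inv c x) %ℕ c)) (units c))

  CharZero : Set ℓ
  CharZero = ∀ (n : ℕ) → (n ℕ.+ 1) × 1# ≈ 0# → ⊥

  NoZeroDivisors : Set (c₁ Level.⊔ ℓ)
  NoZeroDivisors = ∀ x y → x * y ≈ 0# → (x ≈ 0#) ⊎ (y ≈ 0#)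

  PrimitiveRoot : (ζ : Carrier) (c : ℕ) → Set ℓ
  PrimitiveRoot ζ c = (ζ ^ c ≈ 1#) ∧ (∀ k → 0 ℕ.< k → k ℕ.< c → ζ ^ k ≈ 1# → ⊥)

-- Write the Kloosterman sum as ζ^e₁ + ⋯ + ζ^e_L with L = φ(q) = q − 1 terms; it suffices that a
-- vanishing sum of L powers of a primitive q-th root of unity forces q ∣ L.  Let d(X) = Σ X^eᵢ
-- and N(X) = Π_{j<q} d(X^j).  For 0 < s < q some j inverts s modulo q, so N(ζ^s) has the factor
-- d(ζ) = 0.  Summing over s < q therefore gives N(1) = L^q, while orthogonality of the characters
-- s ↦ ζ^{se} evaluates the same sum to q times the number of exponents of N divisible by q.  In
-- characteristic zero this yields q ∣ L^q, hence q ∣ L.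
module Submission where

open import Defs
open import Level using (Level)
open import Function using (_∘_)
open import Data.Nat as ℕ using (ℕ; zero; suc; NonZero; NonTrivial; _<_; z≤n; s≤s)
import Data.Nat.Properties as ℕ
open import Data.Nat.DivMod using (_%_; _/_; %-distribˡ-*; m%n%n≡m%n; [m+kn]%n≡m%n; m%n<n; m≡m%n+[m/n]*n)
open import Data.Nat.Divisibility using (_∣_; _∤_; _∣?_; n∣m*n; m∣m*n; ∣1⇒≡1; >⇒∤; n∣m⇒m%n≡0; m%n≡0⇒n∣m)
open import Data.Nat.Primality using (Prime; prime⇒nonTrivial; euclidsLemma)
open import Data.Nat.Coprimality as Coprime using (Coprime; coprime?; coprime-Bézout; prime⇒coprime)
open import Data.Nat.GCD using (module Bézout)
open import Data.Nat.Tactic.RingSolver using (solve-∀)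
open import Data.Integer as ℤ using (ℤ; +_)
open import Data.Integer.DivMod using (_%ℕ_)
open import Data.List using (List; []; _∷_; _++_; map; foldr; length; upTo; filter; applyUpTo; cartesianProductWith)
open import Data.List.Properties using (length-++; length-map; length-applyUpTo; length-filter; length-upTo; map-∘; filter-accept; filter-reject)
open import Data.List.Membership.Propositional using (_∈_)
open import Data.List.Membership.Propositional.Properties using (∈-upTo⁺)
open import Data.List.Relation.Unary.Any using (here; there)
open import Data.Product using (∃-syntax; _,_; proj₁; proj₂) renaming (_×_ to _∧_)
open import Data.Sum using (inj₁; inj₂)
open import Data.Empty using (⊥-elim)
open import Relation.Nullary using (¬_; yes; no)
open import Relation.Binary.PropositionalEquality as P using (_≡_)
open import Algebra.Bundles using (CommutativeRing; Semiring)
import Algebra.Properties.Semiring.Exp as Exp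
import Algebra.Properties.Monoid.Mult as Mult
import Algebra.Properties.Group as Group
import Algebra.Properties.Ring as Ring

m*[n%o]%o≡m*n%o : ∀ m n o .{{_ : NonZero o}} → (m ℕ.* (n % o)) % o ≡ (m ℕ.* n) % o
m*[n%o]%o≡m*n%o m n o = P.trans (%-distribˡ-* m (n % o) o)
  (P.trans (P.cong (λ k → ((m % o) ℕ.* k) % o) (m%n%n≡m%n n o)) (P.sym (%-distribˡ-* m n o)))

private
  bézout-rearrangement : ∀ s x q′ →
    s ℕ.* (x ℕ.* q′) ℕ.+ (1 ℕ.+ x ℕ.* s) ≡ 1 ℕ.+ (x ℕ.* s) ℕ.* suc q′
  bézout-rearrangement = solve-∀

inverse-mod : ∀ {s q} .{{_ : NonZero q}} → Coprime s q → ∃[ j ] j < q ∧ (s ℕ.* j) % q ≡ 1 % q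
inverse-mod {s} {q@(suc q′)} s⊥q with coprime-Bézout s⊥q
... | Bézout.+- x y 1+yq≡xs = x % q , m%n<n x q , (begin
  (s ℕ.* (x % q)) % q ≡⟨ m*[n%o]%o≡m*n%o s x q ⟩
  (s ℕ.* x) % q       ≡⟨ P.cong (_% q) (P.trans (ℕ.*-comm s x) (P.sym 1+yq≡xs)) ⟩
  (1 ℕ.+ y ℕ.* q) % q ≡⟨ [m+kn]%n≡m%n 1 y q ⟩
  1 % q               ∎)
  where open P.≡-Reasoning
-- Here −x inverts s, and x (q − 1) represents −x.
... | Bézout.-+ x y 1+xs≡yq = j % q , m%n<n j q , (begin
  (s ℕ.* (j % q)) % q                   ≡⟨ m*[n%o]%o≡m*n%o s j q ⟩
  (s ℕ.* j) % q                         ≡⟨ [m+kn]%n≡m%n (s ℕ.* j) y q ⟨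
  (s ℕ.* j ℕ.+ y ℕ.* q) % q             ≡⟨ P.cong (λ k → (s ℕ.* j ℕ.+ k) % q) 1+xs≡yq ⟨
  (s ℕ.* j ℕ.+ (1 ℕ.+ x ℕ.* s)) % q     ≡⟨ P.cong (_% q) (bézout-rearrangement s x q′) ⟩
  (1 ℕ.+ (x ℕ.* s) ℕ.* q) % q           ≡⟨ [m+kn]%n≡m%n 1 (x ℕ.* s) q ⟩
  1 % q                                 ∎)
  where
  open P.≡-Reasoning
  j = x ℕ.* q′

prime∣^⇒∣ : ∀ {p} m n → Prime p → p ∣ m ℕ.^ n → p ∣ m
prime∣^⇒∣ m zero    p-prime p∣1 =
  ⊥-elim (ℕ.nonTrivial⇒≢1 {{prime⇒nonTrivial p-prime}} (∣1⇒≡1 p∣1))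
prime∣^⇒∣ m (suc n) p-prime p∣mⁿ⁺¹ with euclidsLemma m (m ℕ.^ n) p-prime p∣mⁿ⁺¹
... | inj₁ p∣m  = p∣m
... | inj₂ p∣mⁿ = prime∣^⇒∣ m n p-prime p∣mⁿ

module PowerSums {c ℓ : Level} (R : CommutativeRing c ℓ) where
  open CommutativeRing R
  open import Algebra.Definitions.RawSemiring (Semiring.rawSemiring semiring) using (_^_; _×_)
  open import Relation.Binary.Reasoning.Setoid setoid
  open Exp semiring using (^-congˡ; ^-homo-*; ^-assocʳ)
  open Mult +-monoid using (×-congˡ)
  open Group +-group using (∙-cancelˡ; ∙-cancelʳ; x∙y⁻¹≈ε⇒x≈y)
  open Ring ring using (-1*x≈-x)

  1^n≈1 : ∀ n → 1# ^ n ≈ 1#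
  1^n≈1 zero    = refl
  1^n≈1 (suc n) = trans (*-identityˡ _) (1^n≈1 n)

  -- A list of exponents l stands for the polynomial Σ_{e ∈ l} X^e with natural coefficients;
  -- ev x l is its value at x, and _⊛_ below is multiplication of such polynomials.
  ev : Carrier → List ℕ → Carrier
  ev x l = foldr _+_ 0# (map (x ^_) l)

  ev-congˡ : ∀ {x y} l → x ≈ y → ev x l ≈ ev y l
  ev-congˡ []      x≈y = refl
  ev-congˡ (e ∷ l) x≈y = +-cong (^-congˡ e x≈y) (ev-congˡ l x≈y)

  ev-1 : ∀ l → ev 1# l ≈ length l × 1#
  ev-1 []      = refl
  ev-1 (e ∷ l) = +-cong (1^n≈1 e) (ev-1 l)

  ev-++ : ∀ x l₁ l₂ → ev x (l₁ ++ l₂) ≈ ev x l₁ + ev x l₂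
  ev-++ x []       l₂ = sym (+-identityˡ _)
  ev-++ x (e ∷ l₁) l₂ = trans (+-congˡ (ev-++ x l₁ l₂)) (sym (+-assoc _ _ _))

  ev-shift : ∀ x e l → ev x (map (e ℕ.+_) l) ≈ x ^ e * ev x l
  ev-shift x e []      = sym (zeroʳ _)
  ev-shift x e (f ∷ l) = begin
    x ^ (e ℕ.+ f) + ev x (map (e ℕ.+_) l) ≈⟨ +-cong (^-homo-* x e f) (ev-shift x e l) ⟩
    x ^ e * x ^ f + x ^ e * ev x l        ≈⟨ distribˡ _ _ _ ⟨
    x ^ e * (x ^ f + ev x l)              ∎

  ev-scale : ∀ x j l → ev x (map (j ℕ.*_) l) ≈ ev (x ^ j) l
  ev-scale x j []      = refl
  ev-scale x j (e ∷ l) = +-cong (sym (^-assocʳ x j e)) (ev-scale x j l)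

  infixl 7 _⊛_
  _⊛_ : List ℕ → List ℕ → List ℕ
  _⊛_ = cartesianProductWith ℕ._+_

  length-⊛ : ∀ l₁ l₂ → length (l₁ ⊛ l₂) ≡ length l₁ ℕ.* length l₂
  length-⊛ []       l₂ = P.refl
  length-⊛ (e ∷ l₁) l₂ = P.trans (length-++ (map (e ℕ.+_) l₂))
                                 (P.cong₂ ℕ._+_ (length-map _ l₂) (length-⊛ l₁ l₂))

  ev-⊛ : ∀ x l₁ l₂ → ev x (l₁ ⊛ l₂) ≈ ev x l₁ * ev x l₂
  ev-⊛ x []       l₂ = sym (zeroˡ _)
  ev-⊛ x (e ∷ l₁) l₂ = begin
    ev x (map (e ℕ.+_) l₂ ++ l₁ ⊛ l₂)       ≈⟨ ev-++ x (map (e ℕ.+_) l₂) (l₁ ⊛ l₂) ⟩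
    ev x (map (e ℕ.+_) l₂) + ev x (l₁ ⊛ l₂) ≈⟨ +-cong (ev-shift x e l₂) (ev-⊛ x l₁ l₂) ⟩
    x ^ e * ev x l₂ + ev x l₁ * ev x l₂     ≈⟨ distribʳ _ _ _ ⟨
    ev x (e ∷ l₁) * ev x l₂                 ∎

  conjugateProduct : List ℕ → List ℕ → List ℕ
  conjugateProduct []       d = 0 ∷ []
  conjugateProduct (j ∷ js) d = map (j ℕ.*_) d ⊛ conjugateProduct js d

  length-conjugateProduct : ∀ js d → length (conjugateProduct js d) ≡ length d ℕ.^ length js
  length-conjugateProduct []       d = P.refl
  length-conjugateProduct (j ∷ js) d = P.trans (length-⊛ (map (j ℕ.*_) d) _)
    (P.cong₂ ℕ._*_ (length-map _ d) (length-conjugateProduct js d))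

  ev-conjugateProduct≈0 : ∀ x d {j js} → j ∈ js → ev (x ^ j) d ≈ 0# → ev x (conjugateProduct js d) ≈ 0#
  ev-conjugateProduct≈0 x d {js = k ∷ js} j∈js d[x^j]≈0 =
    trans (ev-⊛ x (map (k ℕ.*_) d) _) (zero-factor j∈js)
    where
    zero-factor : _ ∈ k ∷ js → ev x (map (k ℕ.*_) d) * ev x (conjugateProduct js d) ≈ 0#
    zero-factor (here P.refl) = trans (*-congʳ (trans (ev-scale x k d) d[x^j]≈0)) (zeroˡ _)
    zero-factor (there j∈js)  = trans (*-congˡ (ev-conjugateProduct≈0 x d j∈js d[x^j]≈0)) (zeroʳ _)

  sumBelow : ℕ → (ℕ → Carrier) → Carrier
  sumBelow zero    f = 0#
  sumBelow (suc n) f = sumBelow n f + f n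

  sumBelow-cong : ∀ n {f g} → (∀ s → f s ≈ g s) → sumBelow n f ≈ sumBelow n g
  sumBelow-cong zero    f≈g = refl
  sumBelow-cong (suc n) f≈g = +-cong (sumBelow-cong n f≈g) (f≈g n)

  sumBelow-0 : ∀ n → sumBelow n (λ _ → 0#) ≈ 0#
  sumBelow-0 zero    = refl
  sumBelow-0 (suc n) = trans (+-identityʳ _) (sumBelow-0 n)

  sumBelow-+ : ∀ n f g → sumBelow n (λ s → f s + g s) ≈ sumBelow n f + sumBelow n g
  sumBelow-+ zero    f g = sym (+-identityˡ 0#)
  sumBelow-+ (suc n) f g = begin
    sumBelow n (λ s → f s + g s) + (f n + g n)       ≈⟨ +-congʳ (sumBelow-+ n f g) ⟩
    (sumBelow n f + sumBelow n g) + (f n + g n)      ≈⟨ +-assoc _ _ _ ⟩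
    sumBelow n f + (sumBelow n g + (f n + g n))      ≈⟨ +-congˡ (+-comm _ _) ⟩
    sumBelow n f + ((f n + g n) + sumBelow n g)      ≈⟨ +-congˡ (+-assoc _ _ _) ⟩
    sumBelow n f + (f n + (g n + sumBelow n g))      ≈⟨ +-assoc _ _ _ ⟨
    (sumBelow n f + f n) + (g n + sumBelow n g)      ≈⟨ +-congˡ (+-comm _ _) ⟩
    (sumBelow n f + f n) + (sumBelow n g + g n)      ∎

  sumBelow-concentrated : ∀ n .{{_ : NonZero n}} f →
                          (∀ s → 0 < s → s < n → f s ≈ 0#) → sumBelow n f ≈ f 0
  sumBelow-concentrated 1               f _   = +-identityˡ _
  sumBelow-concentrated (suc n@(suc _)) f f≈0 = begin
    sumBelow n f + f n ≈⟨ +-cong (sumBelow-concentrated n f (λ s 0<s s<n → f≈0 s 0<s (ℕ.m<n⇒m<1+n s<n)))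
                                 (f≈0 n (s≤s z≤n) ℕ.≤-refl) ⟩
    f 0 + 0#           ≈⟨ +-identityʳ _ ⟩
    f 0                ∎

  geometric-sum-of-1 : ∀ {x} n → x ≈ 1# → sumBelow n (x ^_) ≈ n × 1#
  geometric-sum-of-1 zero    x≈1 = refl
  geometric-sum-of-1 (suc n) x≈1 =
    trans (+-cong (geometric-sum-of-1 n x≈1) (trans (^-congˡ n x≈1) (1^n≈1 n))) (+-comm _ _)

  geometric-telescope : ∀ x n → x * sumBelow n (x ^_) + 1# ≈ sumBelow n (x ^_) + x ^ n
  geometric-telescope x zero    = +-congʳ (zeroʳ x)
  geometric-telescope x (suc n) = begin
    x * (S + x ^ n) + 1#         ≈⟨ +-congʳ (distribˡ _ _ _) ⟩
    (x * S + x ^ suc n) + 1#     ≈⟨ +-assoc _ _ _ ⟩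
    x * S + (x ^ suc n + 1#)     ≈⟨ +-congˡ (+-comm _ _) ⟩
    x * S + (1# + x ^ suc n)     ≈⟨ +-assoc _ _ _ ⟨
    (x * S + 1#) + x ^ suc n     ≈⟨ +-congʳ (geometric-telescope x n) ⟩
    (S + x ^ n) + x ^ suc n      ∎
    where S = sumBelow n (x ^_)

  geometric-sum≈0 : NoZeroDivisors R → ∀ {x} n → x ^ n ≈ 1# → ¬ (x ≈ 1#) → sumBelow n (x ^_) ≈ 0#
  geometric-sum≈0 noZeroDivisors {x} n xⁿ≈1 x≉1 with noZeroDivisors (x - 1#) S [x-1]S≈0
    where
    S = sumBelow n (x ^_)
    xS≈S : x * S ≈ S
    xS≈S = ∙-cancelʳ 1# _ _ (trans (geometric-telescope x n) (+-congˡ xⁿ≈1))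
    [x-1]S≈0 : (x - 1#) * S ≈ 0#
    [x-1]S≈0 = begin
      (x - 1#) * S       ≈⟨ distribʳ _ _ _ ⟩
      x * S + (- 1#) * S ≈⟨ +-cong xS≈S (-1*x≈-x S) ⟩
      S - S              ≈⟨ -‿inverseʳ S ⟩
      0#                 ∎
  ... | inj₁ x-1≈0 = ⊥-elim (x≉1 (x∙y⁻¹≈ε⇒x≈y _ _ x-1≈0))
  ... | inj₂ S≈0   = S≈0

  ×1-injective : CharZero R → ∀ m n → m × 1# ≈ n × 1# → m ≡ n
  ×1-injective charZero zero    zero    _ = P.refl
  ×1-injective charZero zero    (suc n) 0≈n+1 = ⊥-elim (charZero n (trans (×-congˡ (ℕ.+-comm n 1)) (sym 0≈n+1)))
  ×1-injective charZero (suc m) zero    m+1≈0 = ⊥-elim (charZero m (trans (×-congˡ (ℕ.+-comm m 1)) m+1≈0))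
  ×1-injective charZero (suc m) (suc n) eq    = P.cong suc (×1-injective charZero m n (∙-cancelˡ 1# _ _ eq))

module PrimitiveRootSums {c ℓ : Level} (R : CommutativeRing c ℓ) (noZeroDivisors : NoZeroDivisors R)
  (ζ : CommutativeRing.Carrier R) (q : ℕ) .{{_ : NonZero q}} (ζ-primitive : PrimitiveRoot R ζ q) where

  open CommutativeRing R
  open import Algebra.Definitions.RawSemiring (Semiring.rawSemiring semiring) using (_^_; _×_)
  open import Relation.Binary.Reasoning.Setoid setoid
  open Exp semiring using (^-congˡ; ^-congʳ; ^-homo-*; ^-assocʳ)
  open Mult +-monoid using (×-homo-+; ×-congˡ)
  open PowerSums R

  ζ^n≈ζ^[n%q] : ∀ n → ζ ^ n ≈ ζ ^ (n % q)
  ζ^n≈ζ^[n%q] n = begin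
    ζ ^ n                             ≡⟨ P.cong (ζ ^_) (m≡m%n+[m/n]*n n q) ⟩
    ζ ^ (n % q ℕ.+ (n / q) ℕ.* q)     ≡⟨ P.cong (λ k → ζ ^ (n % q ℕ.+ k)) (ℕ.*-comm (n / q) q) ⟩
    ζ ^ (n % q ℕ.+ q ℕ.* (n / q))     ≈⟨ ^-homo-* ζ (n % q) _ ⟩
    ζ ^ (n % q) * ζ ^ (q ℕ.* (n / q)) ≈⟨ *-congˡ (^-assocʳ ζ q (n / q)) ⟨
    ζ ^ (n % q) * (ζ ^ q) ^ (n / q)   ≈⟨ *-congˡ (trans (^-congˡ (n / q) (proj₁ ζ-primitive)) (1^n≈1 (n / q))) ⟩
    ζ ^ (n % q) * 1#                  ≈⟨ *-identityʳ _ ⟩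
    ζ ^ (n % q)                       ∎

  ζ^-cong-% : ∀ m n → m % q ≡ n % q → ζ ^ m ≈ ζ ^ n
  ζ^-cong-% m n m≡n = trans (ζ^n≈ζ^[n%q] m) (trans (^-congʳ ζ m≡n) (sym (ζ^n≈ζ^[n%q] n)))

  ∣⇒ζ^≈1 : ∀ {e} → q ∣ e → ζ ^ e ≈ 1#
  ∣⇒ζ^≈1 {e} q∣e = trans (ζ^n≈ζ^[n%q] e) (^-congʳ ζ (n∣m⇒m%n≡0 e q q∣e))

  ζ^≈1⇒∣ : ∀ {e} → ζ ^ e ≈ 1# → q ∣ e
  ζ^≈1⇒∣ {e} ζ^e≈1 with e % q ℕ.≟ 0
  ... | yes e%q≡0 = m%n≡0⇒n∣m e q e%q≡0
  ... | no  e%q≢0 = ⊥-elim (proj₂ ζ-primitive (e % q) (ℕ.n≢0⇒n>0 e%q≢0) (m%n<n e q)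
                                                (trans (sym (ζ^n≈ζ^[n%q] e)) ζ^e≈1))

  [ζ^s]^e≈[ζ^e]^s : ∀ s e → (ζ ^ s) ^ e ≈ (ζ ^ e) ^ s
  [ζ^s]^e≈[ζ^e]^s s e = trans (^-assocʳ ζ s e) (trans (^-congʳ ζ (ℕ.*-comm s e)) (sym (^-assocʳ ζ e s)))

  characterSum : ℕ → Carrier
  characterSum e = sumBelow q (λ s → (ζ ^ s) ^ e)

  characterSum-∣ : ∀ {e} → q ∣ e → characterSum e ≈ q × 1#
  characterSum-∣ {e} q∣e =
    trans (sumBelow-cong q (λ s → [ζ^s]^e≈[ζ^e]^s s e)) (geometric-sum-of-1 q (∣⇒ζ^≈1 q∣e))

  characterSum-∤ : ∀ {e} → q ∤ e → characterSum e ≈ 0#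
  characterSum-∤ {e} q∤e = trans (sumBelow-cong q (λ s → [ζ^s]^e≈[ζ^e]^s s e))
    (geometric-sum≈0 noZeroDivisors q (trans (^-assocʳ ζ e q) (∣⇒ζ^≈1 (n∣m*n e))) (q∤e ∘ ζ^≈1⇒∣))

  multiplesOfq : List ℕ → ℕ
  multiplesOfq l = length (filter (q ∣?_) l)

  sumBelow-ev : ∀ l → sumBelow q (λ s → ev (ζ ^ s) l) ≈ (q ℕ.* multiplesOfq l) × 1#
  sumBelow-ev []      = trans (sumBelow-0 q) (sym (×-congˡ (ℕ.*-zeroʳ q)))
  sumBelow-ev (e ∷ l) with q ∣? e
  ... | yes q∣e = begin
    sumBelow q (λ s → (ζ ^ s) ^ e + ev (ζ ^ s) l)      ≈⟨ sumBelow-+ q _ _ ⟩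
    characterSum e + sumBelow q (λ s → ev (ζ ^ s) l)   ≈⟨ +-cong (characterSum-∣ q∣e) (sumBelow-ev l) ⟩
    q × 1# + (q ℕ.* multiplesOfq l) × 1#              ≈⟨ ×-homo-+ 1# q _ ⟨
    (q ℕ.+ q ℕ.* multiplesOfq l) × 1#                 ≡⟨ P.cong (_× 1#) (ℕ.*-suc q _) ⟨
    (q ℕ.* suc (multiplesOfq l)) × 1#                 ∎
  ... | no  q∤e = begin
    sumBelow q (λ s → (ζ ^ s) ^ e + ev (ζ ^ s) l)      ≈⟨ sumBelow-+ q _ _ ⟩
    characterSum e + sumBelow q (λ s → ev (ζ ^ s) l)   ≈⟨ +-cong (characterSum-∤ q∤e) (sumBelow-ev l) ⟩
    0# + (q ℕ.* multiplesOfq l) × 1#                  ≈⟨ +-identityˡ _ ⟩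
    (q ℕ.* multiplesOfq l) × 1#                       ∎

  vanishing-sum⇒∣length : CharZero R → Prime q → ∀ d → ev ζ d ≈ 0# → q ∣ length d
  vanishing-sum⇒∣length charZero q-prime d d[ζ]≈0 =
    prime∣^⇒∣ (length d) q q-prime (P.subst (q ∣_) (P.sym Lᵍ≡q*m) (m∣m*n (multiplesOfq N)))
    where
    N = conjugateProduct (upTo q) d

    N[ζ^s]≈0 : ∀ s → 0 < s → s < q → ev (ζ ^ s) N ≈ 0#
    N[ζ^s]≈0 s 0<s s<q
      with j , j<q , sj≡1 ← inverse-mod (Coprime.sym (prime⇒coprime q-prime {{ℕ.>-nonZero 0<s}} s<q)) =
      ev-conjugateProduct≈0 (ζ ^ s) d (∈-upTo⁺ j<q) (trans (ev-congˡ d ζ^sj≈ζ) d[ζ]≈0)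
      where
      ζ^sj≈ζ : (ζ ^ s) ^ j ≈ ζ
      ζ^sj≈ζ = trans (^-assocʳ ζ s j) (trans (ζ^-cong-% (s ℕ.* j) 1 sj≡1) (*-identityʳ ζ))

    Lᵍ≡q*m : length d ℕ.^ q ≡ q ℕ.* multiplesOfq N
    Lᵍ≡q*m = ×1-injective charZero _ _ (begin
      (length d ℕ.^ q) × 1#               ≡⟨ P.cong (λ n → (length d ℕ.^ n) × 1#) (length-upTo q) ⟨
      (length d ℕ.^ length (upTo q)) × 1# ≡⟨ P.cong (_× 1#) (length-conjugateProduct (upTo q) d) ⟨
      length N × 1#                       ≈⟨ ev-1 N ⟨
      ev 1# N                             ≈⟨ sumBelow-concentrated q (λ s → ev (ζ ^ s) N) N[ζ^s]≈0 ⟨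
      sumBelow q (λ s → ev (ζ ^ s) N)     ≈⟨ sumBelow-ev N ⟩
      (q ℕ.* multiplesOfq N) × 1#         ∎)

units-2+n : ∀ n → units (2 ℕ.+ n) ≡ 1 ∷ filter (λ x → coprime? x (2 ℕ.+ n)) (applyUpTo (2 ℕ.+_) n)
units-2+n n = P.trans
  (filter-reject (λ x → coprime? x (2 ℕ.+ n)) {xs = 1 ∷ applyUpTo (2 ℕ.+_) n} (Coprime.¬0-coprimeTo-2+ {2 ℕ.+ n}))
  (filter-accept (λ x → coprime? x (2 ℕ.+ n)) (Coprime.1-coprimeTo (2 ℕ.+ n)))

∤-length-units : ∀ q .{{_ : NonTrivial q}} → q ∤ length (units q)
∤-length-units (suc (suc n)) rewrite units-2+n n =
  >⇒∤ (s≤s (s≤s (ℕ.≤-trans (length-filter _ (applyUpTo (2 ℕ.+_) n))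
                            (ℕ.≤-reflexive (length-applyUpTo _ n)))))

lemma3p3 : ∀ {c ℓ : Level} (R : CommutativeRing c ℓ)
             → CharZero R → NoZeroDivisors R
             → (q : ℕ) → Prime q → q % 2 ≡ 1
             → (ζ : CommutativeRing.Carrier R) → PrimitiveRoot R ζ q
             → (a : ℤ) → .{{_ : NonZero q}}
             → ¬ (CommutativeRing._≈_ R (kloosterman R ζ (+ 1) a q) (CommutativeRing.0# R))
lemma3p3 R charZero noZeroDivisors q q-prime _ ζ ζ-primitive a S≈0 =
  ∤-length-units q {{prime⇒nonTrivial q-prime}}
    (P.subst (q ∣_) (length-map exponent (units q))
      (vanishing-sum⇒∣length charZero q-prime (map exponent (units q)) (trans ev≈S S≈0)))
  where
  open CommutativeRing R using (trans; reflexive)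
  open PowerSums R using (ev)
  open PrimitiveRootSums R noZeroDivisors ζ q ζ-primitive using (vanishing-sum⇒∣length)

  exponent : ℕ → ℕ
  exponent x = (+ 1 ℤ.* + x ℤ.+ a ℤ.* + inv q x) %ℕ q

  ev≈S : CommutativeRing._≈_ R (ev ζ (map exponent (units q))) (kloosterman R ζ (+ 1) a q)
  ev≈S = reflexive (P.cong (foldr _ _) (P.sym (map-∘ (units q))))
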